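{- There is a one-agent CGS $\mathcal{G}_{Rdc}$ (with agent $\alpha$ and initial state $s_0$) such that, for each $k\in\mathbb{N}$ and each QPTL[$k$-alt] sentence $\varphi$, there exists a variable-closed SL formula $\tilde\varphi$ all of whose subformulas have alternation number at most $k$ (interpreted on turn-based CGSs, i.e. a TBSL[$k$-alt] formula) such that $\varphi$ is satisfiable iff $\mathcal{G}_{Rdc},\chi,s_0\models\tilde\varphi$ for all complete assignments $\chi\in\mathrm{Asg}(\mathrm{Ag},s_0)$.
   Context: QPTL formulas: $\varphi ::= p\mid\neg\varphi\mid\varphi\wedge\varphi\mid\varphi\vee\varphi\mid X\varphi\mid F\varphi\mid G\varphi\mid\exists p.\varphi\mid\forall p.\varphi$. A temporal truth evaluation is a function $\mathbb{N}\to\{\mathrm{false},\mathrm{true}\}$; a propositional truth evaluation $\pi$ is a partial map from atomic propositions to temporal truth evaluations. $\pi,k\models p$ iff $\pi(p)(k)=\mathrm{true}$; Boolean usual; $X\varphi$ iff $\pi,k+1\models\varphi$; $F\varphi$ iff $\exists i\ge k$ with $\pi,i\models\varphi$; $G\varphi$ iff $\forall i\ge k$; $\exists q.\varphi$ (resp. $\forall q.\varphi$) iff for some (resp. all) temporal truth evaluations $t$, $\pi[q\mapsto t],k\models\varphi$. A sentence (no free propositions) is satisfiable iff $\emptyset,0\models\varphi$. Alternation number of QPTL formulas and QPTL[$k$-alt] are defined as for SL below (switches of proposition quantifiers). A concurrent game structure (CGS) is $\langle \mathrm{AP}, \mathrm{Ag}, \mathrm{Ac}, \mathrm{St}, \lambda,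 \tau, s_0\rangle$: finite non-empty atomic propositions and agents, non-empty actions and states, initial state $s_0$, labeling $\lambda:\mathrm{St}\to2^{\mathrm{AP}}$, transition $\tau:\mathrm{St}\times\mathrm{Ac}^{\mathrm{Ag}}\to\mathrm{St}$; turn-based if there is $\mathrm{own}:\mathrm{St}\to\mathrm{Ag}$ with $\tau(s,d_1)=\tau(s,d_2)$ whenever $d_1(\mathrm{own}(s))=d_2(\mathrm{own}(s))$. Tracks: finite non-empty state sequences whose consecutive states are related by $\tau$; $\mathrm{Trk}(s)$ those starting at $s$. Strategies: partial maps tracks$\to\mathrm{Ac}$; $\mathrm{Str}(s)$ those defined exactly on $\mathrm{Trk}(s)$. Assignments: partial maps $\mathrm{Var}\cup\mathrm{Ag}\to$ strategies; complete if defined on all agents; $\mathrm{Asg}(X,s)$ is the set of assignments with domain $X$ and values in $\mathrm{Str}(s)$. Translation $(f)_\rho(\rho')=f(\rho\cdot\rho'_{\ge1})$; $\mathrm{play}(\chi,s)$ is the path $\pi$ with $\pi_0=s$, $\pi_{i+1}=\tau(\pi_i,d_i)$, $d_i(a)=\chi(a)(\pi_0\cdots\pi_i)$; $(\chi,s)^i=((\chi)_{\pi_0\cdots\pi_i},\pi_i)$. SL syntax $\varphi ::= p\mid\neg\varphi\mid\varphi\wedge\varphi\mid\varphi\vee\varphi\mid X\varphi\mid\varphi U\varphi\mid\varphi R\varphi\mid\langle\langle x\rangle\rangle\varphi\mid[[x]]\varphi\mid(a,x)\varphi$ ($F\varphi=\mathrm{true}\,U\varphi$, $G\varphi=\mathrm{false}\,R\varphi$).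 Free agents/variables: atoms none; Boolean union; $X,U,R$ add all agents; quantifiers on $x$ remove $x$; $(a,x)\varphi$: $\mathrm{free}(\varphi)$ if $a\notin\mathrm{free}(\varphi)$, else $(\mathrm{free}(\varphi)\setminus\{a\})\cup\{x\}$; variable-closed: no free variables. Semantics: $p$ iff $p\in\lambda(s)$; Boolean usual; $\langle\langle x\rangle\rangle\varphi$/$[[x]]\varphi$: some/all $f\in\mathrm{Str}(s)$ satisfy $\mathcal{G},\chi[x\mapsto f],s\models\varphi$; $(a,x)\varphi$ iff $\mathcal{G},\chi[a\mapsto\chi(x)],s\models\varphi$; $X,U,R$ for complete $\chi$ as in LTL along $(\chi,s)^i$. Alternation number: maximum number of quantifier switches (existential then universal, universal then existential, existential through negation then existential, universal through negation then universal) binding variables in a subformula that is not a sentence; subsentences treated as atoms, vacuous quantifications ignored. -}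

module Defs where

open import Data.Nat using (ℕ; zero; suc; _+_; _⊔_; _<_; _≤_; _≡ᵇ_)
open import Data.Bool using (Bool; true; false; not; _∧_; _∨_; _xor_; if_then_else_)
open import Data.Fin using (Fin) renaming (_≟_ to _≟F_)
open import Data.List using (List; []; _∷_; _++_)
open import Data.Bool.ListAction using (any)
open import Data.List.NonEmpty using (List⁺; [_]; _⁺++_; _⁺∷ʳ_; last)
open import Data.Maybe using (Maybe; just; nothing; map)
open import Data.Product using (Σ; _×_; _,_; proj₁; ∃)
open import Data.Sum using (_⊎_)
open import Data.Empty using (⊥)
open import Relation.Nullary using (¬_; Dec; yes; no)
open import Relation.Nullary.Decidable using (⌊_⌋)
open import Relation.Binary.PropositionalEquality using (_≡_)

memℕ : ℕ → List ℕ → Bool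
memℕ x xs = any (λ y → x ≡ᵇ y) xs

removeℕ : ℕ → List ℕ → List ℕ
removeℕ x [] = []
removeℕ x (y ∷ ys) = if x ≡ᵇ y then removeℕ x ys else y ∷ removeℕ x ys

anyFin : ∀ {n} → (Fin n → Bool) → Bool
anyFin {zero} f = false
anyFin {suc n} f = f Fin.zero ∨ anyFin (λ i → f (Fin.suc i))

eqF : ∀ {n} → Fin n → Fin n → Bool
eqF i j = ⌊ i ≟F j ⌋

-- number of quantifier switches contributed by a (non-vacuous) quantifier of
-- effective kind e (true = existential), given the effective kind of the
-- nearest enclosing non-vacuous quantifier (nothing = none)
switch : Maybe Bool → Bool → ℕ
switch nothing e = 0
switch (just l) e = if l xor e then 1 else 0

data QPTL : Set where
  prop : ℕ → QPTL
  ¬Q   : QPTL → QPTL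
  _∧Q_ : QPTL → QPTL → QPTL
  _∨Q_ : QPTL → QPTL → QPTL
  XQ   : QPTL → QPTL
  FQ   : QPTL → QPTL
  GQ   : QPTL → QPTL
  ∃Q   : ℕ → QPTL → QPTL
  ∀Q   : ℕ → QPTL → QPTL

TTE : Set
TTE = ℕ → Bool

PTE : Set
PTE = ℕ → Maybe TTE

update : PTE → ℕ → TTE → PTE
update π q t p = if p ≡ᵇ q then just t else π p

holdsAt : Maybe TTE → ℕ → Set
holdsAt nothing k = ⊥
holdsAt (just t) k = t k ≡ true

_,_⊨Q_ : PTE → ℕ → QPTL → Set
π , k ⊨Q prop p = holdsAt (π p) k
π , k ⊨Q ¬Q φ = ¬ (π , k ⊨Q φ)
π , k ⊨Q (φ ∧Q ψ) = (π , k ⊨Q φ) × (π , k ⊨Q ψ)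
π , k ⊨Q (φ ∨Q ψ) = (π , k ⊨Q φ) ⊎ (π , k ⊨Q ψ)
π , k ⊨Q XQ φ = π , suc k ⊨Q φ
π , k ⊨Q FQ φ = Σ ℕ λ i → (k ≤ i) × (π , i ⊨Q φ)
π , k ⊨Q GQ φ = (i : ℕ) → k ≤ i → π , i ⊨Q φ
π , k ⊨Q ∃Q q φ = Σ TTE λ t → update π q t , k ⊨Q φ
π , k ⊨Q ∀Q q φ = (t : TTE) → update π q t , k ⊨Q φ

emptyPTE : PTE
emptyPTE _ = nothing

QSatisfiable : QPTL → Set
QSatisfiable φ = emptyPTE , 0 ⊨Q φ

freeQ : QPTL → List ℕ
freeQ (prop p) = p ∷ []
freeQ (¬Q φ) = freeQ φ
freeQ (φ ∧Q ψ) = freeQ φ ++ freeQ ψ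
freeQ (φ ∨Q ψ) = freeQ φ ++ freeQ ψ
freeQ (XQ φ) = freeQ φ
freeQ (FQ φ) = freeQ φ
freeQ (GQ φ) = freeQ φ
freeQ (∃Q q φ) = removeℕ q (freeQ φ)
freeQ (∀Q q φ) = removeℕ q (freeQ φ)

isSentenceQ : QPTL → Bool
isSentenceQ φ with freeQ φ
... | [] = true
... | _ ∷ _ = false

QSentence : QPTL → Set
QSentence φ = freeQ φ ≡ []

-- alternation number: parity p (true = under an odd number of negations),
-- l = effective kind of the nearest enclosing non-vacuous quantifier.
-- Proper subsentences are treated as atoms; vacuous quantifiers are ignored.
mutual
  altGoQ : Bool → Maybe Bool → QPTL → ℕ
  altGoQ p l φ = if isSentenceQ φ then 0 else altBodyQ p l φ

  altBodyQ : Bool → Maybe Bool → QPTL → ℕ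
  altBodyQ p l (prop _) = 0
  altBodyQ p l (¬Q φ) = altGoQ (not p) l φ
  altBodyQ p l (φ ∧Q ψ) = altGoQ p l φ ⊔ altGoQ p l ψ
  altBodyQ p l (φ ∨Q ψ) = altGoQ p l φ ⊔ altGoQ p l ψ
  altBodyQ p l (XQ φ) = altGoQ p l φ
  altBodyQ p l (FQ φ) = altGoQ p l φ
  altBodyQ p l (GQ φ) = altGoQ p l φ
  altBodyQ p l (∃Q q φ) =
    if memℕ q (freeQ φ)
    then switch l (not p) + altGoQ p (just (not p)) φ
    else altGoQ p l φ
  altBodyQ p l (∀Q q φ) =
    if memℕ q (freeQ φ)
    then switch l p + altGoQ p (just p) φ
    else altGoQ p l φ

altQ : QPTL → ℕ
altQ φ = altBodyQ false nothing φ

data SubQ : QPTL → QPTL → Set where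
  here : ∀ {φ} → SubQ φ φ
  ¬s   : ∀ {ψ φ} → SubQ ψ φ → SubQ ψ (¬Q φ)
  ∧l   : ∀ {ψ φ χ} → SubQ ψ φ → SubQ ψ (φ ∧Q χ)
  ∧r   : ∀ {ψ φ χ} → SubQ ψ χ → SubQ ψ (φ ∧Q χ)
  ∨l   : ∀ {ψ φ χ} → SubQ ψ φ → SubQ ψ (φ ∨Q χ)
  ∨r   : ∀ {ψ φ χ} → SubQ ψ χ → SubQ ψ (φ ∨Q χ)
  Xs   : ∀ {ψ φ} → SubQ ψ φ → SubQ ψ (XQ φ)
  Fs   : ∀ {ψ φ} → SubQ ψ φ → SubQ ψ (FQ φ)
  Gs   : ∀ {ψ φ} → SubQ ψ φ → SubQ ψ (GQ φ)
  ∃s   : ∀ {ψ φ q} → SubQ ψ φ → SubQ ψ (∃Q q φ)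
  ∀s   : ∀ {ψ φ q} → SubQ ψ φ → SubQ ψ (∀Q q φ)

QPTL[_-alt] : ℕ → QPTL → Set
QPTL[ k -alt] φ = ∀ ψ → SubQ ψ φ → altQ ψ ≤ k

record CGS : Set₁ where
  field
    nAP  : ℕ
    nAg  : ℕ
    AP-nonempty : 0 < nAP
    Ag-nonempty : 0 < nAg
    Ac   : Set
    St   : Set
    ac₀  : Ac                      -- Ac is non-empty
    λL   : St → Fin nAP → Bool
    τ    : St → (Fin nAg → Ac) → St
    s₀   : St

IsTurnBased : CGS → Set
IsTurnBased G = Σ (St → Fin nAg) λ own →
  ∀ s (d₁ d₂ : Fin nAg → Ac) → d₁ (own s) ≡ d₂ (own s) → τ s d₁ ≡ τ s d₂
  where open CGS G

data SL (A P : ℕ) : Set where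
  atom  : Fin P → SL A P
  ¬S    : SL A P → SL A P
  _∧S_  : SL A P → SL A P → SL A P
  _∨S_  : SL A P → SL A P → SL A P
  XS    : SL A P → SL A P
  _US_  : SL A P → SL A P → SL A P
  _RS_  : SL A P → SL A P → SL A P
  ⟪_⟫_  : ℕ → SL A P → SL A P
  ⟦_⟧_  : ℕ → SL A P → SL A P
  bind  : Fin A → ℕ → SL A P → SL A P  -- (a,x)φ

module _ {A P : ℕ} where

  freeAg : Fin A → SL A P → Bool
  freeAg a (atom _) = false
  freeAg a (¬S φ) = freeAg a φ
  freeAg a (φ ∧S ψ) = freeAg a φ ∨ freeAg a ψ
  freeAg a (φ ∨S ψ) = freeAg a φ ∨ freeAg a ψ
  freeAg a (XS φ) = true
  freeAg a (φ US ψ) = true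
  freeAg a (φ RS ψ) = true
  freeAg a (⟪ x ⟫ φ) = freeAg a φ
  freeAg a (⟦ x ⟧ φ) = freeAg a φ
  freeAg a (bind b x φ) =
    if freeAg b φ then not (eqF a b) ∧ freeAg a φ else freeAg a φ

  freeVar : SL A P → List ℕ
  freeVar (atom _) = []
  freeVar (¬S φ) = freeVar φ
  freeVar (φ ∧S ψ) = freeVar φ ++ freeVar ψ
  freeVar (φ ∨S ψ) = freeVar φ ++ freeVar ψ
  freeVar (XS φ) = freeVar φ
  freeVar (φ US ψ) = freeVar φ ++ freeVar ψ
  freeVar (φ RS ψ) = freeVar φ ++ freeVar ψ
  freeVar (⟪ x ⟫ φ) = removeℕ x (freeVar φ)
  freeVar (⟦ x ⟧ φ) = removeℕ x (freeVar φ)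
  freeVar (bind b x φ) = if freeAg b φ then x ∷ freeVar φ else freeVar φ

  VarClosed : SL A P → Set
  VarClosed φ = freeVar φ ≡ []

  isSentenceS : SL A P → Bool
  isSentenceS φ with freeVar φ
  ... | _ ∷ _ = false
  ... | [] = not (anyFin (λ a → freeAg a φ))

  mutual
    altGoS : Bool → Maybe Bool → SL A P → ℕ
    altGoS p l φ = if isSentenceS φ then 0 else altBodyS p l φ

    altBodyS : Bool → Maybe Bool → SL A P → ℕ
    altBodyS p l (atom _) = 0
    altBodyS p l (¬S φ) = altGoS (not p) l φ
    altBodyS p l (φ ∧S ψ) = altGoS p l φ ⊔ altGoS p l ψ
    altBodyS p l (φ ∨S ψ) = altGoS p l φ ⊔ altGoS p l ψ
    altBodyS p l (XS φ) = altGoS p l φ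
    altBodyS p l (φ US ψ) = altGoS p l φ ⊔ altGoS p l ψ
    altBodyS p l (φ RS ψ) = altGoS p l φ ⊔ altGoS p l ψ
    altBodyS p l (⟪ x ⟫ φ) =
      if memℕ x (freeVar φ)
      then switch l (not p) + altGoS p (just (not p)) φ
      else altGoS p l φ
    altBodyS p l (⟦ x ⟧ φ) =
      if memℕ x (freeVar φ)
      then switch l p + altGoS p (just p) φ
      else altGoS p l φ
    altBodyS p l (bind b x φ) = altGoS p l φ

  altS : SL A P → ℕ
  altS φ = altBodyS false nothing φ

  data SubS : SL A P → SL A P → Set where
    here : ∀ {φ} → SubS φ φ
    ¬s   : ∀ {ψ φ} → SubS ψ φ → SubS ψ (¬S φ)
    ∧l   : ∀ {ψ φ χ} → SubS ψ φ → SubS ψ (φ ∧S χ)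
    ∧r   : ∀ {ψ φ χ} → SubS ψ χ → SubS ψ (φ ∧S χ)
    ∨l   : ∀ {ψ φ χ} → SubS ψ φ → SubS ψ (φ ∨S χ)
    ∨r   : ∀ {ψ φ χ} → SubS ψ χ → SubS ψ (φ ∨S χ)
    Xs   : ∀ {ψ φ} → SubS ψ φ → SubS ψ (XS φ)
    Ul   : ∀ {ψ φ χ} → SubS ψ φ → SubS ψ (φ US χ)
    Ur   : ∀ {ψ φ χ} → SubS ψ χ → SubS ψ (φ US χ)
    Rl   : ∀ {ψ φ χ} → SubS ψ φ → SubS ψ (φ RS χ)
    Rr   : ∀ {ψ φ χ} → SubS ψ χ → SubS ψ (φ RS χ)
    ⟪s⟫  : ∀ {ψ φ x} → SubS ψ φ → SubS ψ (⟪ x ⟫ φ)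
    ⟦s⟧  : ∀ {ψ φ x} → SubS ψ φ → SubS ψ (⟦ x ⟧ φ)
    bs   : ∀ {ψ φ a x} → SubS ψ φ → SubS ψ (bind a x φ)

  SL[_-alt] : ℕ → SL A P → Set
  SL[ k -alt] φ = ∀ ψ → SubS ψ φ → altS ψ ≤ k

module Semantics (G : CGS) where
  open CGS G

  -- A strategy is represented as a total map on non-empty state sequences;
  -- only its values on tracks matter.
  Strat : Set
  Strat = List⁺ St → Ac

  translate : List⁺ St → Strat → Strat
  translate ρ f ρ' = f (ρ ⁺++ List⁺.tail ρ')

  record Asg : Set where
    constructor asg
    field
      var : ℕ → Maybe Strat
      ag  : Fin nAg → Maybe Strat
  open Asg

  setVar : Asg → ℕ → Strat → Asg
  setVar χ x f = asg (λ y → if y ≡ᵇ x then just f else var χ y) (ag χ)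

  bindAg : Asg → Fin nAg → ℕ → Asg
  bindAg χ a x = asg (var χ) (λ b → if eqF b a then var χ x else ag χ b)

  translateAsg : List⁺ St → Asg → Asg
  translateAsg ρ χ = asg (λ y → map (translate ρ) (var χ y))
                         (λ b → map (translate ρ) (ag χ b))

  Complete : Asg → Set
  Complete χ = (a : Fin nAg) → Σ Strat λ f → ag χ a ≡ just f

  prefix : (Fin nAg → Strat) → St → ℕ → List⁺ St
  prefix σ s zero = [ s ]
  prefix σ s (suc i) = let ρ = prefix σ s i in ρ ⁺∷ʳ τ (last ρ) (λ a → σ a ρ)

  shiftAsg : (χ : Asg) → Complete χ → St → ℕ → Asg
  shiftAsg χ c s i = translateAsg (prefix (λ a → proj₁ (c a)) s i) χ

  shiftSt : (χ : Asg) → Complete χ → St → ℕ → St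
  shiftSt χ c s i = last (prefix (λ a → proj₁ (c a)) s i)

  -- G, χ, s ⊨ φ  (temporal operators require a complete assignment)
  _,_⊨S_ : Asg → St → SL nAg nAP → Set
  χ , s ⊨S atom p = λL s p ≡ true
  χ , s ⊨S ¬S φ = ¬ (χ , s ⊨S φ)
  χ , s ⊨S (φ ∧S ψ) = (χ , s ⊨S φ) × (χ , s ⊨S ψ)
  χ , s ⊨S (φ ∨S ψ) = (χ , s ⊨S φ) ⊎ (χ , s ⊨S ψ)
  χ , s ⊨S XS φ = Σ (Complete χ) λ c → shiftAsg χ c s 1 , shiftSt χ c s 1 ⊨S φ
  χ , s ⊨S (φ US ψ) = Σ (Complete χ) λ c → Σ ℕ λ i →
    (shiftAsg χ c s i , shiftSt χ c s i ⊨S ψ) ×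
    ((j : ℕ) → j < i → shiftAsg χ c s j , shiftSt χ c s j ⊨S φ)
  χ , s ⊨S (φ RS ψ) = Σ (Complete χ) λ c → (i : ℕ) →
    (shiftAsg χ c s i , shiftSt χ c s i ⊨S ψ) ⊎
    (Σ ℕ λ j → (j < i) × (shiftAsg χ c s j , shiftSt χ c s j ⊨S φ))
  χ , s ⊨S (⟪ x ⟫ φ) = Σ Strat λ f → setVar χ x f , s ⊨S φ
  χ , s ⊨S (⟦ x ⟧ φ) = (f : Strat) → setVar χ x f , s ⊨S φ
  χ , s ⊨S bind a x φ = bindAg χ a x , s ⊨S φ

  agentAsg : (Fin nAg → Strat) → Asg
  agentAsg σ = asg (λ _ → nothing) (λ a → just (σ a))

module Submission where

-- In G-Rdc the states and the actions are the Booleans, a move enters the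
-- state named by the action, and the only atom holds in state true.  Along
-- the play of the agent's strategy g from s, every strategy h (the value of
-- a variable) is read as a truth sequence: its i-th value is the action h
-- proposes on the length-(i+1) prefix of that play (`Encodes`).  A
-- proposition q becomes (α,q) X p, a quantifier over q becomes a strategy
-- quantifier over q; when the quantified formula is a QPTL sentence it
-- becomes Q q (α,q) Q q φ̃, which fixes the agent and so is an SL sentence.

open import Defs
open import Data.Nat using (ℕ; zero; suc; _+_; _∸_; _≤_; _<_; _⊔_; z≤n; s≤s; _≡ᵇ_; pred)
open import Data.Nat.Properties
  using (+-identityʳ; +-suc; +-comm; +-assoc; m+n∸m≡n; m≤m+n; m+[n∸m]≡n; ≤-refl; ≤-reflexive; ≤-trans;
         +-monoʳ-≤; ⊔-mono-≤; module ≤-Reasoning; ≡⇒≡ᵇ; ≡ᵇ⇒≡)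
open import Data.Bool using (Bool; true; false; not; _∧_; _∨_; _xor_)
open import Data.Bool.Properties using (T-≡)
open import Data.Fin using (Fin)
open import Data.List using (List; []; _∷_; _++_)
open import Data.List.Properties using (++-assoc; ++-identityʳ; ++-conicalˡ; ++-conicalʳ; length-++)
open import Data.List.NonEmpty using (List⁺; _∷_; [_]; _⁺++_; _⁺∷ʳ_; last; tail)
import Data.List.NonEmpty as List⁺
open import Data.Maybe using (Maybe; just; nothing; map)
open import Data.Maybe.Properties using (just-injective)
open import Data.Maybe.Relation.Binary.Pointwise using (Pointwise; just; nothing)
open import Data.Product using (Σ; _×_; _,_; proj₁; proj₂)
open import Data.Product.Function.NonDependent.Propositional using (_×-⇔_)
open import Data.Sum using (_⊎_; inj₁; inj₂)
open import Data.Sum.Function.Propositional using (_⊎-⇔_)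
open import Data.Empty using (⊥; ⊥-elim)
open import Function using (id; _∘_)
open import Function.Bundles using (_⇔_; mk⇔; Equivalence)
open import Function.Construct.Composition using (_⇔-∘_)
open import Relation.Nullary using (¬_)
open import Relation.Binary.PropositionalEquality hiding ([_])

open Equivalence using (to; from)

-- `Quant true` is ∃ and `Quant false` is ∀; this lets the existential and
-- the universal cases of the reduction be proved once.
Quant : Bool → (A : Set) → (A → Set) → Set
Quant true  A P = Σ A P
Quant false A P = (a : A) → P a

quant-cong : ∀ e {A B : Set} {P : A → Set} {Q : B → Set} (R : A → B → Set) →
             (∀ a → Σ B (R a)) → (∀ b → Σ A λ a → R a b) →
             (∀ {a b} → R a b → P a ⇔ Q b) → Quant e A P ⇔ Quant e B Q
quant-cong true R fwd bwd PQ = mk⇔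
  (λ (a , p) → let (b , r) = fwd a in b , to (PQ r) p)
  (λ (b , q) → let (a , r) = bwd b in a , from (PQ r) q)
quant-cong false R fwd bwd PQ = mk⇔
  (λ h b → let (a , r) = bwd b in to (PQ r) (h a))
  (λ h a → let (b , r) = fwd a in from (PQ r) (h b))

quant-vacuous : ∀ e {A : Set} {P : A → Set} {Y : Set} → A →
                (∀ a → P a ⇔ Y) → Quant e A P ⇔ Y
quant-vacuous true  a₀ PY = mk⇔ (λ (a , p) → to (PY a) p) (λ y → a₀ , from (PY a₀) y)
quant-vacuous false a₀ PY = mk⇔ (λ h → to (PY a₀) (h a₀)) (λ y a → from (PY a) y)

¬-⇔ : ∀ {A B : Set} → A ⇔ B → (¬ A) ⇔ (¬ B)
¬-⇔ A⇔B = mk⇔ (λ ¬a b → ¬a (from A⇔B b)) (λ ¬b a → ¬b (to A⇔B a))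

≡ᵇ-complete : ∀ m n → m ≡ n → (m ≡ᵇ n) ≡ true
≡ᵇ-complete m n eq = to T-≡ (≡⇒≡ᵇ m n eq)

≡ᵇ-sound : ∀ m n → (m ≡ᵇ n) ≡ true → m ≡ n
≡ᵇ-sound m n eq = ≡ᵇ⇒≡ m n (from T-≡ eq)

mem-++ˡ : ∀ p xs ys → memℕ p xs ≡ true → memℕ p (xs ++ ys) ≡ true
mem-++ˡ p (x ∷ xs) ys h with p ≡ᵇ x
... | true  = refl
... | false = mem-++ˡ p xs ys h

mem-++ʳ : ∀ p xs ys → memℕ p ys ≡ true → memℕ p (xs ++ ys) ≡ true
mem-++ʳ p []       ys h = h
mem-++ʳ p (x ∷ xs) ys h with p ≡ᵇ x
... | true  = refl
... | false = mem-++ʳ p xs ys h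

mem-remove : ∀ p q xs → memℕ p xs ≡ true → (p ≡ᵇ q) ≡ false →
             memℕ p (removeℕ q xs) ≡ true
mem-remove p q (y ∷ ys) h p≢q with p ≡ᵇ y in p≡y | q ≡ᵇ y in q≡y
... | true  | true
  with () ← trans (sym p≢q) (≡ᵇ-complete p q (trans (≡ᵇ-sound p y p≡y) (sym (≡ᵇ-sound q y q≡y))))
... | true  | false rewrite p≡y = refl
... | false | true  = mem-remove p q ys h p≢q
... | false | false rewrite p≡y = mem-remove p q ys h p≢q

mem-remove-[] : ∀ p q xs → removeℕ q xs ≡ [] → memℕ p xs ≡ true → p ≡ q
mem-remove-[] p q (y ∷ ys) empty h with q ≡ᵇ y in q≡y
mem-remove-[] p q (y ∷ ys) () h | false
... | true with p ≡ᵇ y in p≡y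
...   | true  = trans (≡ᵇ-sound p y p≡y) (sym (≡ᵇ-sound q y q≡y))
...   | false = mem-remove-[] p q ys empty h

remove-absent : ∀ q xs → memℕ q xs ≡ false → removeℕ q xs ≡ xs
remove-absent q []       _ = refl
remove-absent q (y ∷ ys) h with q ≡ᵇ y
... | false = cong (y ∷_) (remove-absent q ys h)

removed-absent : ∀ q xs → memℕ q (removeℕ q xs) ≡ false
removed-absent q []       = refl
removed-absent q (y ∷ ys) with q ≡ᵇ y in q≡y
... | true  = removed-absent q ys
... | false rewrite q≡y = removed-absent q ys

remove-idem : ∀ q xs → removeℕ q (removeℕ q xs) ≡ removeℕ q xs
remove-idem q []       = refl
remove-idem q (y ∷ ys) with q ≡ᵇ y in q≡y
... | true  = remove-idem q ys
... | false rewrite q≡y = cong (y ∷_) (remove-idem q ys)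

α : Fin 1
α = Fin.zero

G-Rdc : CGS
G-Rdc = record
  { nAP = 1 ; nAg = 1 ; AP-nonempty = s≤s z≤n ; Ag-nonempty = s≤s z≤n
  ; Ac = Bool ; St = Bool ; ac₀ = true
  ; λL = λ s _ → s ; τ = λ _ d → d α ; s₀ = false }

G-Rdc-turnBased : IsTurnBased G-Rdc
G-Rdc-turnBased = (λ _ → α) , λ _ _ _ same-move → same-move

open Semantics G-Rdc
open Asg

Fm : Set
Fm = SL 1 1

run : Strat → List⁺ Bool → ℕ → List⁺ Bool
run g ρ zero    = ρ
run g ρ (suc i) = run g ρ i ⁺∷ʳ g (run g ρ i)

prefix≡run : (σ : Fin 1 → Strat) → ∀ s i → prefix σ s i ≡ run (σ α) [ s ] i
prefix≡run σ s zero    = refl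
prefix≡run σ s (suc i) = cong (λ ρ → ρ ⁺∷ʳ σ α ρ) (prefix≡run σ s i)

run-+ : ∀ g ρ i j → run g (run g ρ i) j ≡ run g ρ (i + j)
run-+ g ρ i zero    rewrite +-identityʳ i = refl
run-+ g ρ i (suc j) rewrite +-suc i j = cong (λ ρ′ → ρ′ ⁺∷ʳ g ρ′) (run-+ g ρ i j)

translate-run : ∀ g ρ x j → ρ ⁺++ tail (run (translate ρ g) [ x ] j) ≡ run g ρ j
translate-run g (r ∷ rs) x zero = cong (r ∷_) (++-identityʳ rs)
translate-run g ρ x (suc j) =
  trans (⁺++-tail-snoc ρ (run (translate ρ g) [ x ] j) _)
        (cong (λ ρ′ → ρ′ ⁺∷ʳ g ρ′) (translate-run g ρ x j))
  where
    ⁺++-tail-snoc : ∀ (ρ E : List⁺ Bool) y → ρ ⁺++ tail (E ⁺∷ʳ y) ≡ (ρ ⁺++ tail E) ⁺∷ʳ y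
    ⁺++-tail-snoc (r ∷ rs) (e ∷ es) y = cong (r ∷_) (sym (++-assoc rs es (y ∷ [])))

length-run : ∀ g s i → List⁺.length (run g [ s ] i) ≡ suc i
length-run g s zero    = refl
length-run g s (suc i) = trans (length-snoc (run g [ s ] i) _) (cong suc (length-run g s i))
  where
    length-snoc : ∀ (E : List⁺ Bool) y → List⁺.length (E ⁺∷ʳ y) ≡ suc (List⁺.length E)
    length-snoc (e ∷ es) y = cong suc (trans (length-++ es) (+-comm _ 1))

Encodes : Strat → Bool → ℕ → Strat → TTE → Set
Encodes g s k h t = ∀ i → h (run g [ s ] i) ≡ t (k + i)

decode : Strat → Bool → ℕ → Strat → TTE
decode g s k h j = h (run g [ s ] (j ∸ k))

-- a strategy encoding t along every run: it only looks at the track length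
encode : ℕ → TTE → Strat
encode k t ρ = t (k + pred (List⁺.length ρ))

decode-encodes : ∀ g s k h → Encodes g s k h (decode g s k h)
decode-encodes g s k h i = cong (h ∘ run g [ s ]) (sym (m+n∸m≡n k i))

encode-encodes : ∀ g s k t → Encodes g s k (encode k t) t
encode-encodes g s k t i = cong (λ n → t (k + pred n)) (length-run g s i)

Encodes-shift : ∀ {g s k h t} i → Encodes g s k h t →
  let ρ = run g [ s ] i in Encodes (translate ρ g) (last ρ) (k + i) (translate ρ h) t
Encodes-shift {g} {s} {k} {h} {t} i enc j =
  begin
    h (ρ ⁺++ tail (run (translate ρ g) [ last ρ ] j)) ≡⟨ cong h (translate-run g ρ (last ρ) j) ⟩
    h (run g ρ j)                                      ≡⟨ cong h (run-+ g [ s ] i j) ⟩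
    h (run g [ s ] (i + j))                            ≡⟨ enc (i + j) ⟩
    t (k + (i + j))                                    ≡⟨ cong t (+-assoc k i j) ⟨
    t (k + i + j)                                      ∎
  where
    open ≡-Reasoning
    ρ = run g [ s ] i

-- At state s and QPTL time k, χ gives the agent a strategy, and on every
-- proposition of xs, χ and π are both undefined or the variable's strategy
-- encodes the truth sequence along the agent's run.
record Agrees (xs : List ℕ) (k : ℕ) (χ : Asg) (s : Bool) (π : PTE) : Set where
  field
    strat : Strat
    agent : ag χ α ≡ just strat
    vars  : ∀ q → memℕ q xs ≡ true → Pointwise (Encodes strat s k) (var χ q) (π q)
open Agrees

restrict : ∀ {xs ys k χ s π} → (∀ q → memℕ q xs ≡ true → memℕ q ys ≡ true) →
           Agrees ys k χ s π → Agrees xs k χ s π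
restrict xs⊆ys A = record { strat = strat A ; agent = agent A ; vars = λ q → vars A q ∘ xs⊆ys q }

complete : ∀ {xs k χ s π} → Agrees xs k χ s π → Complete χ
complete A Fin.zero = strat A , agent A

complete-strat : ∀ {xs k χ s π} (A : Agrees xs k χ s π) (c : Complete χ) → proj₁ (c α) ≡ strat A
complete-strat A c = just-injective (trans (sym (proj₂ (c α))) (agent A))

shift : ∀ {xs k χ s π} → Agrees xs k χ s π → (c : Complete χ) → ∀ i →
        Agrees xs (k + i) (shiftAsg χ c s i) (shiftSt χ c s i) π
shift {xs} {k} {χ} {s} {π} A c i = record
  { strat = translate ρ (strat A)
  ; agent = cong (map (translate ρ)) (agent A)
  ; vars  = λ q m → shift-var (var χ q) (π q) (vars A q m) }
  where
    ρ = prefix (λ a → proj₁ (c a)) s i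
    ρ≡run : ρ ≡ run (strat A) [ s ] i
    ρ≡run = trans (prefix≡run _ s i) (cong (λ g → run g [ s ] i) (complete-strat A c))
    shift-var : ∀ mh mt → Pointwise (Encodes (strat A) s k) mh mt →
                Pointwise (Encodes (translate ρ (strat A)) (last ρ) (k + i)) (map (translate ρ) mh) mt
    shift-var _ _ nothing = nothing
    shift-var (just h) (just t) (just enc) rewrite ρ≡run =
      just (Encodes-shift {strat A} {s} {k} {h} {t} i enc)

agrees-update : ∀ {q xs k χ s π f t} (A : Agrees (removeℕ q xs) k χ s π) →
                Encodes (strat A) s k f t → Agrees xs k (setVar χ q f) s (update π q t)
agrees-update {q} {xs} {χ = χ} {π = π} {f} {t} A enc = record
  { strat = strat A ; agent = agent A ; vars = vars′ }
  where
    vars′ : ∀ p → memℕ p xs ≡ true →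
            Pointwise (Encodes (strat A) _ _) (var (setVar χ q f) p) (update π q t p)
    vars′ p m with p ≡ᵇ q in p=q?
    ... | true  = just enc
    ... | false = vars A p (mem-remove p q xs m p=q?)

-- the closing pattern Q q (α,q) Q q: the agent gets the first value g of q,
-- and when q is the only free proposition nothing else has to agree
agrees-closed : ∀ {q xs k χ s π g f t} → removeℕ q xs ≡ [] → Encodes g s k f t →
                Agrees xs k (setVar (bindAg (setVar χ q g) α q) q f) s (update π q t)
agrees-closed {q} {xs} {k} {χ} {s} {π} {g} {f} {t} only-q enc = record
  { strat = g ; agent = agent′ ; vars = vars′ }
  where
    χ′ = setVar (bindAg (setVar χ q g) α q) q f
    agent′ : ag χ′ α ≡ just g
    agent′ rewrite ≡ᵇ-complete q q refl = refl
    vars′ : ∀ p → memℕ p xs ≡ true → Pointwise (Encodes g s k) (var χ′ p) (update π q t p)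
    vars′ p m rewrite mem-remove-[] p q xs only-q m | ≡ᵇ-complete q q refl = just enc

p₀ : Fin 1
p₀ = Fin.zero

⊤S ⊥S : Fm
⊤S = ¬S (atom p₀ ∧S ¬S (atom p₀))
⊥S = atom p₀ ∧S ¬S (atom p₀)

quantQ : Bool → ℕ → QPTL → QPTL
quantQ true  = ∃Q
quantQ false = ∀Q

quantS : Bool → ℕ → Fm → Fm
quantS true  = ⟪_⟫_
quantS false = ⟦_⟧_

closes : ℕ → QPTL → Bool
closes q φ = isSentenceQ (∃Q q φ) ∧ memℕ q (freeQ φ)

-- the translation of a quantifier over q with body translation t; the
-- closed form Q q (α,q) Q q t first hands the agent a strategy
quantify : (closed : Bool) → Bool → ℕ → Fm → Fm
quantify true  e q t = quantS e q (bind α q (quantS e q t))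
quantify false e q t = quantS e q t

tr : QPTL → Fm
tr (prop q)  = bind α q (XS (atom p₀))
tr (¬Q φ)    = ¬S (tr φ)
tr (φ ∧Q ψ)  = tr φ ∧S tr ψ
tr (φ ∨Q ψ)  = tr φ ∨S tr ψ
tr (XQ φ)    = XS (tr φ)
tr (FQ φ)    = ⊤S US tr φ
tr (GQ φ)    = ⊥S RS tr φ
tr (∃Q q φ)  = quantify (closes q φ) true q (tr φ)
tr (∀Q q φ)  = quantify (closes q φ) false q (tr φ)

closes-true : ∀ q φ → closes q φ ≡ true →
              removeℕ q (freeQ φ) ≡ [] × memℕ q (freeQ φ) ≡ true
closes-true q φ c with removeℕ q (freeQ φ) | memℕ q (freeQ φ)
... | []    | true = refl , refl

closes-false : ∀ q φ → closes q φ ≡ false → removeℕ q (freeQ φ) ≡ [] →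
               memℕ q (freeQ φ) ≡ false
closes-false q φ c empty with removeℕ q (freeQ φ) | memℕ q (freeQ φ)
... | [] | false = refl

freeAg-quantS : ∀ e a x t → freeAg a (quantS e x t) ≡ freeAg a t
freeAg-quantS true  a x t = refl
freeAg-quantS false a x t = refl

freeVar-quantS : ∀ e x t → freeVar (quantS e x t) ≡ removeℕ x (freeVar t)
freeVar-quantS true  x t = refl
freeVar-quantS false x t = refl

freeVar-quantify : ∀ b e q t → freeVar (quantify b e q t) ≡ removeℕ q (freeVar t)
freeVar-quantify false e q t = freeVar-quantS e q t
freeVar-quantify true  e q t
  rewrite freeVar-quantS e q (bind α q (quantS e q t)) | freeAg-quantS e α q t
        | freeVar-quantS e q t
  with freeAg α t
... | true  rewrite ≡ᵇ-complete q q refl = remove-idem q (freeVar t)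
... | false = remove-idem q (freeVar t)

tr-freeVar : ∀ φ → freeVar (tr φ) ≡ freeQ φ
tr-freeVar (prop q) = refl
tr-freeVar (¬Q φ)   = tr-freeVar φ
tr-freeVar (φ ∧Q ψ) = cong₂ _++_ (tr-freeVar φ) (tr-freeVar ψ)
tr-freeVar (φ ∨Q ψ) = cong₂ _++_ (tr-freeVar φ) (tr-freeVar ψ)
tr-freeVar (XQ φ)   = tr-freeVar φ
tr-freeVar (FQ φ)   = tr-freeVar φ
tr-freeVar (GQ φ)   = tr-freeVar φ
tr-freeVar (∃Q q φ) = trans (freeVar-quantify (closes q φ) true q (tr φ)) (cong (removeℕ q) (tr-freeVar φ))
tr-freeVar (∀Q q φ) = trans (freeVar-quantify (closes q φ) false q (tr φ)) (cong (removeℕ q) (tr-freeVar φ))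

mem-tr : ∀ q θ → memℕ q (freeVar (tr θ)) ≡ memℕ q (freeQ θ)
mem-tr q θ = cong (memℕ q) (tr-freeVar θ)

sat-quantS : ∀ e {χ s x φ} → (χ , s ⊨S quantS e x φ) ⇔ Quant e Strat (λ f → setVar χ x f , s ⊨S φ)
sat-quantS true  = mk⇔ id id
sat-quantS false = mk⇔ id id

-- quantifying over strategies for q amounts to quantifying over truth
-- sequences for q, since encoding is a bi-total relation
quant-encodes : ∀ e g s k {P : Strat → Set} {Q : TTE → Set} →
                (∀ {f t} → Encodes g s k f t → P f ⇔ Q t) → Quant e Strat P ⇔ Quant e TTE Q
quant-encodes e g s k = quant-cong e (Encodes g s k)
  (λ f → decode g s k f , decode-encodes g s k f) (λ t → encode k t , encode-encodes g s k t)

Correct : QPTL → Set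
Correct θ = ∀ {k χ s π} → Agrees (freeQ θ) k χ s π → (χ , s ⊨S tr θ) ⇔ (π , k ⊨Q θ)

-- (α,q) X p holds iff the strategy of q moves to true now
correct-prop : ∀ q → Correct (prop q)
correct-prop q {k} {χ} {s} {π} A
  with var χ q | π q | vars A q (cong (_∨ false) (≡ᵇ-complete q q refl))
... | nothing | nothing | nothing = mk⇔ (λ (c , _) → undefined (proj₂ (c α))) λ ()
  where
    undefined : ∀ {f : Strat} → _≡_ {A = Maybe Strat} nothing (just f) → ⊥
    undefined ()
... | just h  | just t  | just enc = mk⇔
  (λ (c , moved) → trans (sym now) (trans (cong (λ f → f [ s ]) (just-injective (proj₂ (c α)))) moved))
  (λ tk → (λ { Fin.zero → h , refl }) , trans now tk)
  where
    now : h [ s ] ≡ t k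
    now = trans (enc 0) (cong t (+-identityʳ k))

correct-X : ∀ θ → Correct θ → Correct (XQ θ)
correct-X θ IH {k} {χ} {s} {π} A = mk⇔
  (λ (c , h) → subst at (+-comm k 1) (to (IH (shift A c 1)) h))
  (λ h → let c = complete A in c , from (IH (shift A c 1)) (subst at (+-comm 1 k) h))
  where
    at : ℕ → Set
    at n = π , n ⊨Q θ

correct-F : ∀ θ → Correct θ → Correct (FQ θ)
correct-F θ IH {k} {χ} {s} {π} A = mk⇔
  (λ (c , i , h , _) → k + i , m≤m+n k i , to (IH (shift A c i)) h)
  (λ (i , k≤i , h) → let c = complete A in
     c , i ∸ k , from (IH (shift A c (i ∸ k))) (subst at (sym (m+[n∸m]≡n k≤i)) h) ,
     λ _ _ (a , ¬a) → ¬a a)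
  where
    at : ℕ → Set
    at n = π , n ⊨Q θ

correct-G : ∀ θ → Correct θ → Correct (GQ θ)
correct-G θ IH {k} {χ} {s} {π} A = mk⇔
  (λ (c , H) i k≤i → now-or-never c k≤i (H (i ∸ k)))
  (λ H → let c = complete A in
     c , λ i → inj₁ (from (IH (shift A c i)) (H (k + i) (m≤m+n k i))))
  where
    at : ℕ → Set
    at n = π , n ⊨Q θ
    -- the release never holds by its left operand ⊥S
    now-or-never : (c : Complete χ) → ∀ {i} → k ≤ i →
      (shiftAsg χ c s (i ∸ k) , shiftSt χ c s (i ∸ k) ⊨S tr θ) ⊎
      Σ ℕ (λ j → (j < i ∸ k) × (shiftAsg χ c s j , shiftSt χ c s j ⊨S ⊥S)) → at i
    now-or-never c k≤i (inj₁ h) = subst at (m+[n∸m]≡n k≤i) (to (IH (shift A c _)) h)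
    now-or-never c k≤i (inj₂ (_ , _ , (a , ¬a))) = ⊥-elim (¬a a)

-- a quantifier over q: plain strategy quantification tracks the
-- agent's current strategy; the closed form starts a fresh agent strategy
-- (its value is irrelevant) along which the inner quantifier is read
correct-quant : ∀ e q θ → Correct θ → ∀ {k χ s π} → Agrees (removeℕ q (freeQ θ)) k χ s π →
  (χ , s ⊨S quantify (closes q θ) e q (tr θ)) ⇔ Quant e TTE (λ t → update π q t , k ⊨Q θ)
correct-quant e q θ IH {k} {χ} {s} {π} A with closes q θ in closed
... | false = quant-encodes e (strat A) s k (IH ∘ agrees-update A) ⇔-∘ sat-quantS e
... | true  = quant-vacuous e (λ _ → true) (λ g →
                quant-encodes e g s k (IH ∘ agrees-closed only-q) ⇔-∘ sat-quantS e)
              ⇔-∘ sat-quantS e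
  where
    only-q = proj₁ (closes-true q θ closed)

tr-correct : ∀ θ → Correct θ
tr-correct (prop q) = correct-prop q
tr-correct (¬Q θ) A = ¬-⇔ (tr-correct θ A)
tr-correct (φ ∧Q ψ) A =
  tr-correct φ (restrict (λ q → mem-++ˡ q (freeQ φ) (freeQ ψ)) A) ×-⇔
  tr-correct ψ (restrict (λ q → mem-++ʳ q (freeQ φ) (freeQ ψ)) A)
tr-correct (φ ∨Q ψ) A =
  tr-correct φ (restrict (λ q → mem-++ˡ q (freeQ φ) (freeQ ψ)) A) ⊎-⇔
  tr-correct ψ (restrict (λ q → mem-++ʳ q (freeQ φ) (freeQ ψ)) A)
tr-correct (XQ θ)   = correct-X θ (tr-correct θ)
tr-correct (FQ θ)   = correct-F θ (tr-correct θ)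
tr-correct (GQ θ)   = correct-G θ (tr-correct θ)
tr-correct (∃Q q θ) = correct-quant true q θ (tr-correct θ)
tr-correct (∀Q q θ) = correct-quant false q θ (tr-correct θ)

-- in context a formula counts at most as much as its body (subsentences
-- count as atoms)
altGoS≤altBodyS : ∀ p l (ψ : Fm) → altGoS p l ψ ≤ altBodyS p l ψ
altGoS≤altBodyS p l ψ with isSentenceS ψ
... | true  = z≤n
... | false = ≤-refl

altGoS-bind≤ : ∀ p l a x (ψ : Fm) → altGoS p l (bind a x ψ) ≤ altBodyS p l ψ
altGoS-bind≤ p l a x ψ = ≤-trans (altGoS≤altBodyS p l (bind a x ψ)) (altGoS≤altBodyS p l ψ)

altGoS-body0 : ∀ p l (ψ : Fm) → altBodyS p l ψ ≡ 0 → altGoS p l ψ ≡ 0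
altGoS-body0 p l ψ body0 with isSentenceS ψ
... | true  = refl
... | false = body0

altGoS-sentence : ∀ p l (ψ : Fm) → freeVar ψ ≡ [] → freeAg α ψ ≡ false → altGoS p l ψ ≡ 0
altGoS-sentence p l ψ noVar noAgent rewrite noVar | noAgent = refl

-- a quantifier of kind e under parity p has effective kind e xor p; it
-- adds its switch iff it binds a free variable (proposition)
altBodyS-quant-free : ∀ e p l x (t : Fm) → memℕ x (freeVar t) ≡ true →
  altBodyS p l (quantS e x t) ≡ switch l (e xor p) + altGoS p (just (e xor p)) t
altBodyS-quant-free true  p l x t free rewrite free = refl
altBodyS-quant-free false p l x t free rewrite free = refl

altBodyS-quant-vac : ∀ e p l x (t : Fm) → memℕ x (freeVar t) ≡ false →
  altBodyS p l (quantS e x t) ≡ altGoS p l t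
altBodyS-quant-vac true  p l x t vac rewrite vac = refl
altBodyS-quant-vac false p l x t vac rewrite vac = refl

altBodyQ-quant-free : ∀ e p l q θ → memℕ q (freeQ θ) ≡ true →
  altBodyQ p l (quantQ e q θ) ≡ switch l (e xor p) + altGoQ p (just (e xor p)) θ
altBodyQ-quant-free true  p l q θ free rewrite free = refl
altBodyQ-quant-free false p l q θ free rewrite free = refl

altBodyQ-quant-vac : ∀ e p l q θ → memℕ q (freeQ θ) ≡ false →
  altBodyQ p l (quantQ e q θ) ≡ altGoQ p l θ
altBodyQ-quant-vac true  p l q θ vac rewrite vac = refl
altBodyQ-quant-vac false p l q θ vac rewrite vac = refl

switch-same : ∀ b → switch (just b) b ≡ 0
switch-same true  = refl
switch-same false = refl

closed-agent-bound : ∀ e q t → freeAg α (quantify true e q t) ≡ false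
closed-agent-bound e q t rewrite freeAg-quantS e α q (bind α q (quantS e q t))
  with freeAg α (quantS e q t)
... | true  = refl
... | false = refl

-- a closed quantifier is an SL sentence; an unclosed quantifier over a
-- sentence is vacuous
quant-sentence-alt : ∀ e q θ → (freeQ θ ≡ [] → ∀ p l → altGoS p l (tr θ) ≡ 0) →
  removeℕ q (freeQ θ) ≡ [] → ∀ p l → altGoS p l (quantify (closes q θ) e q (tr θ)) ≡ 0
quant-sentence-alt e q θ IH closed p l with closes q θ in closing
... | true  = altGoS-sentence p l (quantify true e q (tr θ))
  (trans (freeVar-quantify true e q (tr θ)) (trans (cong (removeℕ q) (tr-freeVar θ)) closed))
  (closed-agent-bound e q (tr θ))
... | false = altGoS-body0 p l (quantS e q (tr θ)) (trans
  (altBodyS-quant-vac e p l q (tr θ) (trans (mem-tr q θ) absent))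
  (IH (trans (sym (remove-absent q (freeQ θ) absent)) closed) p l))
  where
    absent = closes-false q θ closing closed

tr-sentence-alt : ∀ θ → freeQ θ ≡ [] → ∀ p l → altGoS p l (tr θ) ≡ 0
tr-sentence-alt (prop q) ()
tr-sentence-alt (¬Q θ) closed p l =
  altGoS-body0 p l (tr (¬Q θ)) (tr-sentence-alt θ closed (not p) l)
tr-sentence-alt (φ ∧Q ψ) closed p l = altGoS-body0 p l (tr (φ ∧Q ψ)) (cong₂ _⊔_
  (tr-sentence-alt φ (++-conicalˡ _ _ closed) p l) (tr-sentence-alt ψ (++-conicalʳ (freeQ φ) _ closed) p l))
tr-sentence-alt (φ ∨Q ψ) closed p l = altGoS-body0 p l (tr (φ ∨Q ψ)) (cong₂ _⊔_
  (tr-sentence-alt φ (++-conicalˡ _ _ closed) p l) (tr-sentence-alt ψ (++-conicalʳ (freeQ φ) _ closed) p l))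
tr-sentence-alt (XQ θ) closed p l = altGoS-body0 p l (tr (XQ θ)) (tr-sentence-alt θ closed p l)
tr-sentence-alt (FQ θ) closed p l = altGoS-body0 p l (tr (FQ θ)) (tr-sentence-alt θ closed p l)
tr-sentence-alt (GQ θ) closed p l = altGoS-body0 p l (tr (GQ θ)) (tr-sentence-alt θ closed p l)
tr-sentence-alt (∃Q q θ) = quant-sentence-alt true q θ (tr-sentence-alt θ)
tr-sentence-alt (∀Q q θ) = quant-sentence-alt false q θ (tr-sentence-alt θ)

closed-q-free : ∀ e q (t : Fm) → freeAg α t ≡ true → memℕ q (freeVar (bind α q (quantS e q t))) ≡ true
closed-q-free e q t agentFree rewrite freeAg-quantS e α q t | agentFree | ≡ᵇ-complete q q refl = refl

closed-q-vacuous : ∀ e q (t : Fm) → freeAg α t ≡ false → memℕ q (freeVar (bind α q (quantS e q t))) ≡ false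
closed-q-vacuous e q t agentBound
  rewrite freeAg-quantS e α q t | agentBound | freeVar-quantS e q t = removed-absent q (freeVar t)

open ≤-Reasoning

plain-altBody : ∀ e q θ → (∀ p l → altGoS p l (tr θ) ≤ altGoQ p l θ) →
  ∀ p l → altBodyS p l (quantS e q (tr θ)) ≤ altBodyQ p l (quantQ e q θ)
plain-altBody e q θ IH p l with memℕ q (freeQ θ) in m
... | true = begin
  altBodyS p l (quantS e q (tr θ))              ≡⟨ altBodyS-quant-free e p l q (tr θ) (trans (mem-tr q θ) m) ⟩
  switch l (e xor p) + altGoS p E (tr θ)        ≤⟨ +-monoʳ-≤ (switch l (e xor p)) (IH p E) ⟩
  switch l (e xor p) + altGoQ p E θ             ≡⟨ altBodyQ-quant-free e p l q θ m ⟨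
  altBodyQ p l (quantQ e q θ)                   ∎
  where E = just (e xor p)
... | false = begin
  altBodyS p l (quantS e q (tr θ))  ≡⟨ altBodyS-quant-vac e p l q (tr θ) (trans (mem-tr q θ) m) ⟩
  altGoS p l (tr θ)                 ≤⟨ IH p l ⟩
  altGoQ p l θ                      ≡⟨ altBodyQ-quant-vac e p l q θ m ⟨
  altBodyQ p l (quantQ e q θ)       ∎

-- the closing pattern counts no more: its two quantifiers have the same
-- kind, so at most the outer one contributes a switch
closed-altBody : ∀ e q θ → (∀ p l → altGoS p l (tr θ) ≤ altGoQ p l θ) →
  memℕ q (freeQ θ) ≡ true →
  ∀ p l → altBodyS p l (quantify true e q (tr θ)) ≤ altBodyQ p l (quantQ e q θ)
closed-altBody e q θ IH m p l with freeAg α (tr θ) in agent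
... | true = begin
  altBodyS p l (quantS e q B)                         ≡⟨ altBodyS-quant-free e p l q B (closed-q-free e q (tr θ) agent) ⟩
  s + altGoS p E B                                    ≤⟨ +-monoʳ-≤ s (altGoS-bind≤ p E α q (quantS e q (tr θ))) ⟩
  s + altBodyS p E (quantS e q (tr θ))                ≤⟨ +-monoʳ-≤ s (plain-altBody e q θ IH p E) ⟩
  s + altBodyQ p E (quantQ e q θ)                     ≡⟨ cong (s +_) (altBodyQ-quant-free e p E q θ m) ⟩
  s + (switch E (e xor p) + altGoQ p E θ)             ≡⟨ cong (λ n → s + (n + altGoQ p E θ)) (switch-same (e xor p)) ⟩
  s + altGoQ p E θ                                    ≡⟨ altBodyQ-quant-free e p l q θ m ⟨
  altBodyQ p l (quantQ e q θ)                         ∎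
  where B = bind α q (quantS e q (tr θ))
        E = just (e xor p)
        s = switch l (e xor p)
... | false = begin
  altBodyS p l (quantS e q B)           ≡⟨ altBodyS-quant-vac e p l q B (closed-q-vacuous e q (tr θ) agent) ⟩
  altGoS p l B                          ≤⟨ altGoS-bind≤ p l α q (quantS e q (tr θ)) ⟩
  altBodyS p l (quantS e q (tr θ))      ≤⟨ plain-altBody e q θ IH p l ⟩
  altBodyQ p l (quantQ e q θ)           ∎
  where B = bind α q (quantS e q (tr θ))

quant-altBody : ∀ e q θ → (∀ p l → altGoS p l (tr θ) ≤ altGoQ p l θ) →
  ∀ p l → altBodyS p l (quantify (closes q θ) e q (tr θ)) ≤ altBodyQ p l (quantQ e q θ)
quant-altBody e q θ IH p l with closes q θ in closing
... | false = plain-altBody e q θ IH p l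
... | true  = closed-altBody e q θ IH (proj₂ (closes-true q θ closing)) p l

mutual
  tr-altGo : ∀ θ p l → altGoS p l (tr θ) ≤ altGoQ p l θ
  tr-altGo θ p l with freeQ θ in fq
  ... | []    = ≤-reflexive (tr-sentence-alt θ fq p l)
  ... | _ ∷ _ = ≤-trans (altGoS≤altBodyS p l (tr θ)) (tr-altBody θ p l)

  tr-altBody : ∀ θ p l → altBodyS p l (tr θ) ≤ altBodyQ p l θ
  tr-altBody (prop q) p l = z≤n
  tr-altBody (¬Q θ)   p l = tr-altGo θ (not p) l
  tr-altBody (φ ∧Q ψ) p l = ⊔-mono-≤ (tr-altGo φ p l) (tr-altGo ψ p l)
  tr-altBody (φ ∨Q ψ) p l = ⊔-mono-≤ (tr-altGo φ p l) (tr-altGo ψ p l)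
  tr-altBody (XQ θ)   p l = tr-altGo θ p l
  tr-altBody (FQ θ)   p l = tr-altGo θ p l
  tr-altBody (GQ θ)   p l = tr-altGo θ p l
  tr-altBody (∃Q q θ) p l = quant-altBody true q θ (tr-altGo θ) p l
  tr-altBody (∀Q q θ) p l = quant-altBody false q θ (tr-altGo θ) p l

module _ {k : ℕ} where

  kalt-atom : (a : Fin 1) → SL[ k -alt] (atom {1} a)
  kalt-atom a _ here = z≤n

  kalt-¬ : {φ : Fm} → altS (¬S φ) ≤ k → SL[ k -alt] φ → SL[ k -alt] (¬S φ)
  kalt-¬ top sub _ here    = top
  kalt-¬ top sub ψ (¬s s)  = sub ψ s

  kalt-∧ : {φ χ : Fm} → altS (φ ∧S χ) ≤ k → SL[ k -alt] φ → SL[ k -alt] χ → SL[ k -alt] (φ ∧S χ)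
  kalt-∧ top subl subr _ here   = top
  kalt-∧ top subl subr ψ (∧l s) = subl ψ s
  kalt-∧ top subl subr ψ (∧r s) = subr ψ s

  kalt-∨ : {φ χ : Fm} → altS (φ ∨S χ) ≤ k → SL[ k -alt] φ → SL[ k -alt] χ → SL[ k -alt] (φ ∨S χ)
  kalt-∨ top subl subr _ here   = top
  kalt-∨ top subl subr ψ (∨l s) = subl ψ s
  kalt-∨ top subl subr ψ (∨r s) = subr ψ s

  kalt-X : {φ : Fm} → altS (XS φ) ≤ k → SL[ k -alt] φ → SL[ k -alt] (XS φ)
  kalt-X top sub _ here   = top
  kalt-X top sub ψ (Xs s) = sub ψ s

  kalt-U : {φ χ : Fm} → altS (φ US χ) ≤ k → SL[ k -alt] φ → SL[ k -alt] χ → SL[ k -alt] (φ US χ)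
  kalt-U top subl subr _ here   = top
  kalt-U top subl subr ψ (Ul s) = subl ψ s
  kalt-U top subl subr ψ (Ur s) = subr ψ s

  kalt-R : {φ χ : Fm} → altS (φ RS χ) ≤ k → SL[ k -alt] φ → SL[ k -alt] χ → SL[ k -alt] (φ RS χ)
  kalt-R top subl subr _ here   = top
  kalt-R top subl subr ψ (Rl s) = subl ψ s
  kalt-R top subl subr ψ (Rr s) = subr ψ s

  kalt-quantS : ∀ e {x} {φ : Fm} → altS (quantS e x φ) ≤ k → SL[ k -alt] φ → SL[ k -alt] (quantS e x φ)
  kalt-quantS true  top sub _ here    = top
  kalt-quantS true  top sub ψ (⟪s⟫ s) = sub ψ s
  kalt-quantS false top sub _ here    = top
  kalt-quantS false top sub ψ (⟦s⟧ s) = sub ψ s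

  kalt-bind : ∀ {a x} {φ : Fm} → altS (bind a x φ) ≤ k → SL[ k -alt] φ → SL[ k -alt] (bind a x φ)
  kalt-bind top sub _ here   = top
  kalt-bind top sub ψ (bs s) = sub ψ s

  kalt-⊤S : SL[ k -alt] ⊤S
  kalt-⊤S = kalt-¬ z≤n (kalt-∧ z≤n (kalt-atom p₀) (kalt-¬ z≤n (kalt-atom p₀)))

  kalt-⊥S : SL[ k -alt] ⊥S
  kalt-⊥S = kalt-∧ z≤n (kalt-atom p₀) (kalt-¬ z≤n (kalt-atom p₀))

  -- a quantifier over q: both formulas of the closing pattern below the
  -- outer quantifier count at most as the plain quantifier does
  kalt-quantify : ∀ e q θ → altS (quantify (closes q θ) e q (tr θ)) ≤ k →
    altS (quantS e q (tr θ)) ≤ k → SL[ k -alt] (tr θ) → SL[ k -alt] (quantify (closes q θ) e q (tr θ))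
  kalt-quantify e q θ top plain sub with closes q θ
  ... | false = kalt-quantS e top sub
  ... | true  = kalt-quantS e top
    (kalt-bind (≤-trans (altGoS≤altBodyS false nothing (quantS e q (tr θ))) plain) (kalt-quantS e plain sub))

tr-altS : ∀ {k} θ → QPTL[ k -alt] θ → altS (tr θ) ≤ k
tr-altS θ H = ≤-trans (tr-altBody θ false nothing) (H θ here)

tr-kalt : ∀ {k} θ → QPTL[ k -alt] θ → SL[ k -alt] (tr θ)
tr-kalt (prop q) H = kalt-bind z≤n (kalt-X z≤n (kalt-atom p₀))
tr-kalt (¬Q θ)   H = kalt-¬ (tr-altS (¬Q θ) H) (tr-kalt θ (λ ψ → H ψ ∘ ¬s))
tr-kalt (φ ∧Q χ) H = kalt-∧ (tr-altS (φ ∧Q χ) H) (tr-kalt φ (λ ψ → H ψ ∘ ∧l)) (tr-kalt χ (λ ψ → H ψ ∘ ∧r))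
tr-kalt (φ ∨Q χ) H = kalt-∨ (tr-altS (φ ∨Q χ) H) (tr-kalt φ (λ ψ → H ψ ∘ ∨l)) (tr-kalt χ (λ ψ → H ψ ∘ ∨r))
tr-kalt (XQ θ)   H = kalt-X (tr-altS (XQ θ) H) (tr-kalt θ (λ ψ → H ψ ∘ Xs))
tr-kalt (FQ θ)   H = kalt-U (tr-altS (FQ θ) H) kalt-⊤S (tr-kalt θ (λ ψ → H ψ ∘ Fs))
tr-kalt (GQ θ)   H = kalt-R (tr-altS (GQ θ) H) kalt-⊥S (tr-kalt θ (λ ψ → H ψ ∘ Gs))
tr-kalt (∃Q q θ) H = kalt-quantify true q θ (tr-altS (∃Q q θ) H)
  (≤-trans (plain-altBody true q θ (tr-altGo θ) false nothing) (H _ here)) (tr-kalt θ (λ ψ → H ψ ∘ ∃s))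
tr-kalt (∀Q q θ) H = kalt-quantify false q θ (tr-altS (∀Q q θ) H)
  (≤-trans (plain-altBody false q θ (tr-altGo θ) false nothing) (H _ here)) (tr-kalt θ (λ ψ → H ψ ∘ ∀s))

-- φ̃ = tr φ; satisfiability gives validity under every agent strategy, and
-- validity under any single strategy gives satisfiability
lemma3p4 : Σ CGS λ G → (CGS.nAg G ≡ 1) × IsTurnBased G ×
    ((k : ℕ) (φ : QPTL) → QSentence φ → QPTL[ k -alt] φ →
    Σ (SL (CGS.nAg G) (CGS.nAP G)) λ φ̃ → VarClosed φ̃ × SL[ k -alt] φ̃ ×
    (QSatisfiable φ ⇔
    ((σ : Fin (CGS.nAg G) → Semantics.Strat G) → Semantics._,_⊨S_ G (Semantics.agentAsg G σ) (CGS.s₀ G) φ̃)))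
lemma3p4 = G-Rdc , refl , G-Rdc-turnBased , λ k φ sentence φ-alt →
  tr φ , trans (tr-freeVar φ) sentence , tr-kalt φ φ-alt ,
  mk⇔ (λ sat σ → from (tr-correct φ (initial (freeQ φ) σ)) sat)
      (λ valid → to (tr-correct φ (initial (freeQ φ) (λ _ _ → true))) (valid (λ _ _ → true)))
  where
    initial : ∀ xs σ → Agrees xs 0 (agentAsg σ) false emptyPTE
    initial xs σ = record { strat = σ α ; agent = refl ; vars = λ _ _ → nothing }
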